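{- For $p\in\{102,201\}$: $\sum_{n\geq 0}|\mathcal{C}_n(p)|x^n=\frac{1-3x+x^2}{(1-x)(1-3x)}$, and $|\mathcal{C}_n(p)|=\frac{3^{n-1}+1}{2}$ for all $n\geq 1$. Moreover, for all $n\geq 2$ the popularity of descents $\sum_{w\in\mathcal{C}_n(p)}d(w)$ equals $(n-2)\cdot 3^{n-3}$, and $\sum_{n\geq 0}\big(\sum_{w\in\mathcal{C}_n(p)}d(w)\big)x^n=\frac{x^3}{(1-3x)^2}$.
   Context: A Catalan word of length $n\geq 1$ is a word $w_1\ldots w_n$ over the non-negative integers with $w_1=0$ and $0\leq w_i\leq w_{i-1}+1$ for $2\leq i\leq n$; the empty word is the unique Catalan word of length $0$. A word $w$ contains the pattern $p=p_1\ldots p_k$ if there are indices $i_1<\cdots<i_k$ such that $w_{i_1}\ldots w_{i_k}$ is order-isomorphic to $p$ (for all $a,b$: $w_{i_a}<w_{i_b}$ iff $p_a<p_b$, and $w_{i_a}=w_{i_b}$ iff $p_a=p_b$); otherwise $w$ avoids $p$. $\mathcal{C}_n(p)$ is the set of Catalan words of length $n$ avoiding $p$. A descent of $w$ is an index $i$ with $w_i>w_{i+1}$; $d(w)$ denotes the number of descents of $w$. -}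

module Defs where

open import Data.Nat using (ℕ; zero; suc; _≤_; _<_; _<ᵇ_)
open import Data.Bool using (if_then_else_)
open import Data.Integer as ℤ using (ℤ)
open import Data.Fin using (Fin; cast)
open import Data.List using (List; []; _∷_; length; lookup)
open import Data.List.Relation.Binary.Sublist.Propositional using (_⊆_)
open import Data.Product using (Σ; ∃; _×_)
open import Data.Unit using (⊤)
open import Function.Bundles using (_⇔_)
open import Relation.Binary.PropositionalEquality using (_≡_)
open import Relation.Nullary using (¬_)

StepsFrom : ℕ → List ℕ → Set
StepsFrom prev []       = ⊤
StepsFrom prev (x ∷ xs) = (x ≤ suc prev) × StepsFrom x xs

CatalanWord : List ℕ → Set
CatalanWord []       = ⊤
CatalanWord (x ∷ xs) = (x ≡ 0) × StepsFrom x xs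

OrderIso : List ℕ → List ℕ → Set
OrderIso s p = Σ (length s ≡ length p) λ e → ∀ (a b : Fin (length s)) →
  ((lookup s a < lookup s b) ⇔ (lookup p (cast e a) < lookup p (cast e b)))
  × ((lookup s a ≡ lookup s b) ⇔ (lookup p (cast e a) ≡ lookup p (cast e b)))

Contains : List ℕ → List ℕ → Set
Contains w p = ∃ λ s → (s ⊆ w) × OrderIso s p

Avoids : List ℕ → List ℕ → Set
Avoids w p = ¬ Contains w p

des : List ℕ → ℕ
des []           = 0
des (x ∷ [])     = 0
des (x ∷ y ∷ xs) = if y <ᵇ x then suc (des (y ∷ xs)) else des (y ∷ xs)

p102 : List ℕ
p102 = 1 ∷ 0 ∷ 2 ∷ []

p201 : List ℕ
p201 = 2 ∷ 0 ∷ 1 ∷ []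

FPS : Set
FPS = ℕ → ℤ

sumUpTo : ℕ → (ℕ → ℤ) → ℤ
sumUpTo zero    f = f 0
sumUpTo (suc n) f = sumUpTo n f ℤ.+ f (suc n)

_⊛_ : FPS → FPS → FPS
(f ⊛ g) n = sumUpTo n (λ k → f k ℤ.* g (n Data.Nat.∸ k))

-- polynomial given by its coefficient list (constant term first)
poly : List ℤ → FPS
poly []       n       = ℤ.+ 0
poly (c ∷ cs) zero    = c
poly (c ∷ cs) (suc n) = poly cs n

-- Split a non-constant Catalan word avoiding 102 at its last 0, as w₁ 0 (w₂+1), and one avoiding 201
-- at its first return to 0, as 0 (w₁+1) w₂. Avoidance forces one of the two factors to be constant,
-- so every non-constant avoider of length n+1 arises in exactly one way from an avoider of length n:
-- by prefixing a 0, shifting, inserting or appending a letter. Hence the numbers c n of avoiders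
-- satisfy c (n+2) = 3 c (n+1) - 1, and counting the descents each construction creates gives
-- d (n+3) = 3 d (n+2) + 3ⁿ for the descent totals; closed forms and generating functions follow.

module Submission where

open import Defs
open import Data.Bool using (true; false; if_then_else_)
open import Data.Empty using (⊥; ⊥-elim)
open import Data.Fin using (zero; suc)
open import Data.Integer as ℤ using (ℤ; +_; -[1+_])
import Data.Integer.Properties as ℤ
import Data.Integer.Tactic.RingSolver as ℤ-Solver
open import Data.List using (List; []; _∷_; [_]; length; map; _++_; replicate; head)
open import Data.List.Properties
  using (∷-injective; ∷-injectiveʳ; ∷ʳ-injectiveˡ; ∷ʳ-injectiveʳ; map-injective; map-replicate; map-++; map-∘; map-cong-local
        ; ++-identityʳ; ++-assoc; length-replicate; length-++; length-map; length-++-sucʳ)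
open import Data.List.Membership.Propositional using (_∈_)
open import Data.List.Membership.Propositional.Properties using (∈-map⁺; ∈-map⁻; ∈-++⁺ˡ; ∈-++⁺ʳ; ∈-++⁻)
open import Data.List.Relation.Binary.Sublist.Propositional
  using (_⊆_; []; _∷_; _∷ʳ_; ⊆-refl; ⊆-trans; minimum)
open import Data.List.Relation.Binary.Sublist.Propositional.Properties using (All-resp-⊆)
import Data.List.Relation.Binary.Sublist.Propositional.Properties as Sublist
open import Data.List.Relation.Unary.All using (All; []; _∷_)
import Data.List.Relation.Unary.All as All
import Data.List.Relation.Unary.All.Properties as All
open import Data.List.Relation.Unary.AllPairs using ([]; _∷_)
open import Data.List.Relation.Unary.Any using (here; there)
open import Data.List.Relation.Unary.Unique.Propositional using (Unique)
import Data.List.Relation.Unary.Unique.Propositional.Properties as Unique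
open import Data.Maybe.Relation.Unary.All using (just; nothing) renaming (All to MaybeAll)
open import Data.Nat using (ℕ; zero; suc; _≤_; _<_; _+_; _*_; _∸_; _^_; _/_; _<ᵇ_; _≟_; z≤n; s≤s; s≤s⁻¹)
open import Data.Nat.DivMod using (m*n/n≡m)
open import Data.Nat.ListAction using (sum)
open import Data.Nat.ListAction.Properties using (sum-++)
open import Data.Nat.Properties using (<-irrefl; <-asym; <-trans; <-≤-trans; ≤-refl; n≮0; +-comm; +-identityʳ; 0≢1+n; +-cancelʳ-≡; *-comm; suc-injective)
import Data.Nat.Tactic.RingSolver as ℕ-Solver
open import Data.Product using (Σ; ∃; ∃₂; _×_; _,_; proj₁; proj₂)
import Data.Product as Product
open import Data.Sum using (_⊎_; inj₁; inj₂)
open import Data.Unit using (tt)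
open import Function using (_∘_)
open import Function.Bundles using (_⇔_; mk⇔; Equivalence)
open import Relation.Binary.PropositionalEquality
  using (_≡_; _≢_; refl; sym; trans; cong; cong₂; subst; module ≡-Reasoning)
open import Relation.Nullary using (¬_; yes; no)
open import Relation.Unary using (Decidable)
open import Function.Related.TypeIsomorphisms using (¬-cong-⇔)

private variable
  A B : Set
  a b c m n p q x : ℕ
  u v w w₁ w₂ z xs ys : List ℕ

Occurs : (ℕ → ℕ → ℕ → Set) → List ℕ → Set
Occurs R w = Σ ℕ λ a → Σ ℕ λ b → Σ ℕ λ c → (a ∷ b ∷ c ∷ []) ⊆ w × R a b c

Shape102 Shape201 : ℕ → ℕ → ℕ → Set
Shape102 a b c = b < a × a < c
Shape201 a b c = b < c × c < a

SameOrder : ℕ → ℕ → ℕ → ℕ → Set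
SameOrder a b m n = ((a < b) ⇔ (m < n)) × ((a ≡ b) ⇔ (m ≡ n))

sameOrder-< : a < b → m < n → SameOrder a b m n
sameOrder-< a<b m<n = mk⇔ (λ _ → m<n) (λ _ → a<b) ,
  mk⇔ (λ { refl → ⊥-elim (<-irrefl refl a<b) }) (λ { refl → ⊥-elim (<-irrefl refl m<n) })

sameOrder-> : b < a → n < m → SameOrder a b m n
sameOrder-> b<a n<m = mk⇔ (λ a<b → ⊥-elim (<-asym a<b b<a)) (λ m<n → ⊥-elim (<-asym m<n n<m)) ,
  mk⇔ (λ { refl → ⊥-elim (<-irrefl refl b<a) }) (λ { refl → ⊥-elim (<-irrefl refl n<m) })

sameOrder-≡ : SameOrder a a m m
sameOrder-≡ = mk⇔ (λ a<a → ⊥-elim (<-irrefl refl a<a)) (λ m<m → ⊥-elim (<-irrefl refl m<m)) ,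
  mk⇔ (λ _ → refl) (λ _ → refl)

0<1 : 0 < 1
0<1 = s≤s z≤n

1<2 : 1 < 2
1<2 = s≤s (s≤s z≤n)

0<2 : 0 < 2
0<2 = s≤s z≤n

shape102⇒orderIso : Shape102 a b c → OrderIso (a ∷ b ∷ c ∷ []) p102
shape102⇒orderIso (b<a , a<c) = refl , λ where
  zero             zero             → sameOrder-≡
  zero             (suc zero)       → sameOrder-> b<a 0<1
  zero             (suc (suc zero)) → sameOrder-< a<c 1<2
  (suc zero)       zero             → sameOrder-< b<a 0<1
  (suc zero)       (suc zero)       → sameOrder-≡
  (suc zero)       (suc (suc zero)) → sameOrder-< (<-trans b<a a<c) 0<2
  (suc (suc zero)) zero             → sameOrder-> a<c 1<2
  (suc (suc zero)) (suc zero)       → sameOrder-> (<-trans b<a a<c) 0<2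
  (suc (suc zero)) (suc (suc zero)) → sameOrder-≡

shape201⇒orderIso : Shape201 a b c → OrderIso (a ∷ b ∷ c ∷ []) p201
shape201⇒orderIso (b<c , c<a) = refl , λ where
  zero             zero             → sameOrder-≡
  zero             (suc zero)       → sameOrder-> (<-trans b<c c<a) 0<2
  zero             (suc (suc zero)) → sameOrder-> c<a 1<2
  (suc zero)       zero             → sameOrder-< (<-trans b<c c<a) 0<2
  (suc zero)       (suc zero)       → sameOrder-≡
  (suc zero)       (suc (suc zero)) → sameOrder-< b<c 0<1
  (suc (suc zero)) zero             → sameOrder-< c<a 1<2
  (suc (suc zero)) (suc zero)       → sameOrder-> b<c 0<1
  (suc (suc zero)) (suc (suc zero)) → sameOrder-≡

occurs⇔contains102 : Occurs Shape102 w ⇔ Contains w p102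
occurs⇔contains102 = mk⇔ (λ (_ , _ , _ , τ , r) → _ , τ , shape102⇒orderIso r) occurrence
  where
  occurrence : Contains w p102 → Occurs Shape102 w
  occurrence (a ∷ b ∷ c ∷ [] , τ , _ , iso) =
    a , b , c , τ , Equivalence.from (proj₁ (iso (suc zero) zero)) 0<1
                  , Equivalence.from (proj₁ (iso zero (suc (suc zero)))) 1<2
  occurrence ([] , _ , () , _)
  occurrence (_ ∷ [] , _ , () , _)
  occurrence (_ ∷ _ ∷ [] , _ , () , _)
  occurrence (_ ∷ _ ∷ _ ∷ _ ∷ _ , _ , () , _)

occurs⇔contains201 : Occurs Shape201 w ⇔ Contains w p201
occurs⇔contains201 = mk⇔ (λ (_ , _ , _ , τ , r) → _ , τ , shape201⇒orderIso r) occurrence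
  where
  occurrence : Contains w p201 → Occurs Shape201 w
  occurrence (a ∷ b ∷ c ∷ [] , τ , _ , iso) =
    a , b , c , τ , Equivalence.from (proj₁ (iso (suc zero) (suc (suc zero)))) 0<1
                  , Equivalence.from (proj₁ (iso (suc (suc zero)) zero)) 1<2
  occurrence ([] , _ , () , _)
  occurrence (_ ∷ [] , _ , () , _)
  occurrence (_ ∷ _ ∷ [] , _ , () , _)
  occurrence (_ ∷ _ ∷ _ ∷ _ ∷ _ , _ , () , _)

zeros ones : ℕ → List ℕ
zeros n = replicate n 0
ones n = replicate n 1

shift : List ℕ → List ℕ
shift w = 0 ∷ map suc w

length≡0⇒[] : ∀ (w : List A) → length w ≡ 0 → w ≡ []
length≡0⇒[] [] _ = refl

replicate-snoc : ∀ k (x : A) → replicate k x ++ [ x ] ≡ x ∷ replicate k x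
replicate-snoc zero    x = refl
replicate-snoc (suc k) x = cong (x ∷_) (replicate-snoc k x)

length-snoc : ∀ (v : List A) x → length (v ++ [ x ]) ≡ suc (length v)
length-snoc v x = trans (length-++ v) (+-comm (length v) 1)

length-map-++ : ∀ (f g : A → B) xs ys → length (map f xs ++ map g ys) ≡ length xs + length ys
length-map-++ f g xs ys = trans (length-++ (map f xs)) (cong₂ _+_ (length-map f xs) (length-map g ys))

unique-map-++ : ∀ {f g : A → B} {xs ys} →
  (∀ {x y} → f x ≡ f y → x ≡ y) → (∀ {x y} → g x ≡ g y → x ≡ y) →
  (∀ {x y} → x ∈ xs → y ∈ ys → f x ≢ g y) →
  Unique xs → Unique ys → Unique (map f xs ++ map g ys)
unique-map-++ {f = f} {g} {xs} {ys} f-inj g-inj f≢g uxs uys =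
  Unique.++⁺ (Unique.map⁺ f-inj uxs) (Unique.map⁺ g-inj uys) λ (v∈f , v∈g) →
    disjoint (∈-map⁻ f v∈f) (∈-map⁻ g v∈g)
  where
  disjoint : ∀ {v} → (∃ λ x → x ∈ xs × v ≡ f x) → (∃ λ y → y ∈ ys × v ≡ g y) → ⊥
  disjoint (x , x∈ , refl) (y , y∈ , e) = f≢g x∈ y∈ e

∷ʳ-⊆-++ : ∀ (us : List A) xs {vs y} → xs ++ [ y ] ⊆ us ++ vs → xs ++ [ y ] ⊆ us ⊎ [ y ] ⊆ vs
∷ʳ-⊆-++ []       xs       τ = inj₂ (⊆-trans (Sublist.++⁺ˡ xs ⊆-refl) τ)
∷ʳ-⊆-++ (u ∷ us) []       (_ ∷ʳ τ) with ∷ʳ-⊆-++ us [] τ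
... | inj₁ σ = inj₁ (u ∷ʳ σ)
... | inj₂ σ = inj₂ σ
∷ʳ-⊆-++ (u ∷ us) []       (refl ∷ τ) = inj₁ (refl ∷ minimum us)
∷ʳ-⊆-++ (u ∷ us) (x ∷ xs) (_ ∷ʳ τ) with ∷ʳ-⊆-++ us (x ∷ xs) τ
... | inj₁ σ = inj₁ (u ∷ʳ σ)
... | inj₂ σ = inj₂ σ
∷ʳ-⊆-++ (u ∷ us) (_ ∷ xs) (refl ∷ τ) with ∷ʳ-⊆-++ us xs τ
... | inj₁ σ = inj₁ (refl ∷ σ)
... | inj₂ σ = inj₂ σ

∷-⊆-++ : ∀ (us : List A) {xs vs y} → y ∷ xs ⊆ us ++ vs → [ y ] ⊆ us ⊎ y ∷ xs ⊆ vs
∷-⊆-++ []       τ = inj₂ τ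
∷-⊆-++ (u ∷ us) (_ ∷ʳ τ) with ∷-⊆-++ us τ
... | inj₁ σ = inj₁ (u ∷ʳ σ)
... | inj₂ σ = inj₂ σ
∷-⊆-++ (u ∷ us) (refl ∷ τ) = inj₁ (refl ∷ minimum us)

⊆-map-preimage : ∀ (f : A → B) ys {xs} → xs ⊆ map f ys → ∃ λ xs′ → xs ≡ map f xs′ × xs′ ⊆ ys
⊆-map-preimage f []       [] = [] , refl , []
⊆-map-preimage f (y ∷ ys) (_ ∷ʳ τ) with ⊆-map-preimage f ys τ
... | xs′ , refl , σ = xs′ , refl , y ∷ʳ σ
⊆-map-preimage f (y ∷ ys) (refl ∷ τ) with ⊆-map-preimage f ys τ
... | xs′ , refl , σ = y ∷ xs′ , refl , refl ∷ σ

module _ {R : ℕ → ℕ → ℕ → Set} where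

  NeverFirst NeverLast : ℕ → Set
  NeverFirst a = ∀ {b c} → ¬ R a b c
  NeverLast c = ∀ {a b} → ¬ R a b c

  occurs-⊆ : xs ⊆ ys → Occurs R xs → Occurs R ys
  occurs-⊆ τ (a , b , c , σ , r) = a , b , c , ⊆-trans σ τ , r

  avoids-[] : ¬ Occurs R []
  avoids-[] (_ , _ , _ , () , _)

  avoids-++-neverLast : ¬ Occurs R u → All NeverLast v → ¬ Occurs R (u ++ v)
  avoids-++-neverLast {u} u-avoids v-never (a , b , c , τ , r) with ∷ʳ-⊆-++ u (a ∷ b ∷ []) τ
  ... | inj₁ σ = u-avoids (a , b , c , σ , r)
  ... | inj₂ σ = All.head (All-resp-⊆ σ v-never) r

  avoids-++-neverFirst : All NeverFirst u → ¬ Occurs R v → ¬ Occurs R (u ++ v)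
  avoids-++-neverFirst {u} u-never v-avoids (a , b , c , τ , r) with ∷-⊆-++ u τ
  ... | inj₁ σ = All.head (All-resp-⊆ σ u-never) r
  ... | inj₂ σ = v-avoids (a , b , c , σ , r)

  avoids-++⁻ˡ : ∀ u → ¬ Occurs R (u ++ v) → ¬ Occurs R u
  avoids-++⁻ˡ u uv-avoids = uv-avoids ∘ occurs-⊆ (Sublist.++⁺ʳ _ ⊆-refl)

  avoids-++⁻ʳ : ∀ u → ¬ Occurs R (u ++ v) → ¬ Occurs R v
  avoids-++⁻ʳ u uv-avoids = uv-avoids ∘ occurs-⊆ (Sublist.++⁺ˡ u ⊆-refl)

  occurs-map-suc : (∀ {a b c} → R a b c → R (suc a) (suc b) (suc c)) → Occurs R w → Occurs R (map suc w)
  occurs-map-suc R-suc (a , b , c , τ , r) = suc a , suc b , suc c , Sublist.map⁺ suc τ , R-suc r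

  occurs-map-suc⁻ : (∀ {a b c} → R (suc a) (suc b) (suc c) → R a b c) → Occurs R (map suc w) → Occurs R w
  occurs-map-suc⁻ {w} R-pred (a , b , c , τ , r) with ⊆-map-preimage suc w τ
  ... | _ ∷ _ ∷ _ ∷ [] , refl , σ = _ , _ , _ , σ , R-pred r

  avoids-shift : NeverFirst 0 → (∀ {a b c} → R (suc a) (suc b) (suc c) → R a b c) →
    ¬ Occurs R w → ¬ Occurs R (shift w)
  avoids-shift never-0 R-pred w-avoids =
    avoids-++-neverFirst (never-0 ∷ []) (w-avoids ∘ occurs-map-suc⁻ R-pred)

AllZero AllPositive HeadZero : List ℕ → Set
AllZero = All (_≡ 0)
AllPositive = All (0 <_)
HeadZero w = MaybeAll (_≡ 0) (head w)

¬allPositive-0 : ∀ u → ¬ AllPositive (u ++ 0 ∷ z)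
¬allPositive-0 u u0z>0 = n≮0 (All.head (All.++⁻ʳ u u0z>0))

allZero⇒zeros : AllZero w → w ≡ zeros (length w)
allZero⇒zeros []         = refl
allZero⇒zeros (refl ∷ z) = cong (0 ∷_) (allZero⇒zeros z)

allZero? : Decidable AllZero
allZero? = All.all? (_≟ 0)

steps-++⁻ˡ : ∀ p u → StepsFrom p (u ++ v) → StepsFrom p u
steps-++⁻ˡ p []      _       = tt
steps-++⁻ˡ p (x ∷ u) (h , s) = h , steps-++⁻ˡ x u s

steps-++⁻ʳ : ∀ p u → StepsFrom p (u ++ x ∷ z) → StepsFrom x z
steps-++⁻ʳ p []      (_ , s) = s
steps-++⁻ʳ p (y ∷ u) (_ , s) = steps-++⁻ʳ y u s

steps-++ : ∀ p u → StepsFrom p u → (∀ q → StepsFrom q v) → StepsFrom p (u ++ v)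
steps-++ p []      _       sv = sv p
steps-++ p (x ∷ u) (h , s) sv = h , steps-++ x u s sv

steps-map-suc : ∀ xs → StepsFrom p xs → StepsFrom (suc p) (map suc xs)
steps-map-suc []       _       = tt
steps-map-suc (x ∷ xs) (h , s) = s≤s h , steps-map-suc xs s

steps-map-suc⁻ : ∀ xs → StepsFrom (suc p) xs → AllPositive xs →
  ∃ λ ys → xs ≡ map suc ys × StepsFrom p ys
steps-map-suc⁻ []           _           _       = [] , refl , tt
steps-map-suc⁻ (suc x ∷ xs) (s≤s h , s) (_ ∷ a) with steps-map-suc⁻ xs s a
... | ys , refl , s′ = x ∷ ys , refl , h , s′

steps-1 : ∀ xs → StepsFrom 0 xs → ¬ AllZero xs → [ 1 ] ⊆ xs
steps-1 []                 _           xs≢0 = ⊥-elim (xs≢0 [])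
steps-1 (zero ∷ xs)        (_ , s)     xs≢0 = 0 ∷ʳ steps-1 xs s (λ xs≡0 → xs≢0 (refl ∷ xs≡0))
steps-1 (suc zero ∷ xs)    _           _    = refl ∷ minimum xs
steps-1 (suc (suc x) ∷ xs) (s≤s () , _) _

catalan-steps : CatalanWord v → StepsFrom q v
catalan-steps {[]}    _          = tt
catalan-steps {_ ∷ _} (refl , s) = z≤n , s

catalan-head : CatalanWord w → w ≢ [] → ∃ λ t → w ≡ 0 ∷ t
catalan-head {[]}    _         w≢[] = ⊥-elim (w≢[] refl)
catalan-head {_ ∷ t} (refl , _) _   = t , refl

catalan-headZero : CatalanWord w → HeadZero w
catalan-headZero {[]}    _          = nothing
catalan-headZero {_ ∷ _} (refl , _) = just refl

catalan-++ : ∀ u → CatalanWord u → CatalanWord v → CatalanWord (u ++ v)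
catalan-++ []      _          cv = cv
catalan-++ (_ ∷ u) (refl , s) cv = refl , steps-++ 0 u s (λ _ → catalan-steps cv)

catalan-++⁻ˡ : ∀ u → CatalanWord (u ++ v) → CatalanWord u
catalan-++⁻ˡ []      _       = tt
catalan-++⁻ˡ (x ∷ u) (e , s) = e , steps-++⁻ˡ x u s

catalan-++⁻ʳ : ∀ u → HeadZero v → CatalanWord (u ++ v) → CatalanWord v
catalan-++⁻ʳ         []      _           cv      = cv
catalan-++⁻ʳ {[]}    (_ ∷ _) _           _       = tt
catalan-++⁻ʳ {_ ∷ _} (x ∷ u) (just refl) (_ , s) = refl , steps-++⁻ʳ x u s

catalan-shift : CatalanWord w → CatalanWord (shift w)
catalan-shift {[]}    _          = refl , tt
catalan-shift {_ ∷ w} (refl , s) = refl , ≤-refl , steps-map-suc w s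

catalan-shift⁻ : StepsFrom 0 z → AllPositive z → ∃ λ w → z ≡ map suc w × CatalanWord w
catalan-shift⁻ {[]}                _            _       = [] , refl , tt
catalan-shift⁻ {suc zero ∷ z}      (_ , s)      (_ ∷ a) with steps-map-suc⁻ z s a
... | w , refl , s′ = 0 ∷ w , refl , refl , s′
catalan-shift⁻ {suc (suc _) ∷ _}   (s≤s () , _) _

catalan-zeros : ∀ n → CatalanWord (zeros n)
catalan-zeros zero    = tt
catalan-zeros (suc n) = refl , catalan-steps (catalan-zeros n)

catalan-ones : ∀ k → CatalanWord (0 ∷ ones k)
catalan-ones k = subst (λ t → CatalanWord (0 ∷ t)) (map-replicate suc k 0) (catalan-shift (catalan-zeros k))

catalan-¬allZero : CatalanWord w → ¬ AllZero w → (0 ∷ 1 ∷ []) ⊆ w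
catalan-¬allZero {[]}    _          w≢0 = ⊥-elim (w≢0 [])
catalan-¬allZero {_ ∷ t} (refl , s) w≢0 = refl ∷ steps-1 t s (λ t≡0 → w≢0 (refl ∷ t≡0))

≤1-ones : ∀ k → All (_≤ 1) (0 ∷ ones k)
≤1-ones k = z≤n ∷ All.replicate⁺ k ≤-refl

catalan-¬allZero⇒1 : CatalanWord w → ¬ AllZero w → [ 1 ] ⊆ w
catalan-¬allZero⇒1 c w≢0 = ⊆-trans (0 ∷ʳ ⊆-refl) (catalan-¬allZero c w≢0)

catalan-map-suc : CatalanWord (map suc w) → w ≡ []
catalan-map-suc {[]} _ = refl
catalan-map-suc {_ ∷ _} (() , _)

¬allZero-shift : w ≢ [] → ¬ AllZero (shift w)
¬allZero-shift {[]}    w≢[] _             = w≢[] refl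
¬allZero-shift {_ ∷ _} _    (_ ∷ () ∷ _)

allPositive-map-suc : ∀ w → AllPositive (map suc w)
allPositive-map-suc w = All.map⁺ (All.universal (λ _ → s≤s z≤n) w)

lastZero-split : ∀ t → (∃₂ λ u z → t ≡ u ++ 0 ∷ z × AllPositive z) ⊎ AllPositive t
lastZero-split []      = inj₂ []
lastZero-split (y ∷ t) with lastZero-split t
... | inj₁ (u , z , refl , z>0) = inj₁ (y ∷ u , z , refl , z>0)
lastZero-split (zero ∷ t)  | inj₂ t>0 = inj₁ ([] , t , refl , t>0)
lastZero-split (suc _ ∷ t) | inj₂ t>0 = inj₂ (s≤s z≤n ∷ t>0)

catalan-lastZero : CatalanWord w → w ≢ [] →
  ∃₂ λ w₁ w₂ → w ≡ w₁ ++ shift w₂ × CatalanWord w₁ × CatalanWord w₂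
catalan-lastZero {w} cw w≢[] with lastZero-split w
... | inj₁ (u , z , refl , z>0) with catalan-shift⁻ (proj₂ (catalan-++⁻ʳ u (just refl) cw)) z>0
...   | w₂ , refl , cw₂ = u , w₂ , refl , catalan-++⁻ˡ u cw , cw₂
catalan-lastZero cw w≢[] | inj₂ w>0 with catalan-head cw w≢[]
... | _ , refl = ⊥-elim (n≮0 (All.head w>0))

firstZero-split : ∀ t → ∃₂ λ u v → t ≡ u ++ v × AllPositive u × HeadZero v
firstZero-split []          = [] , [] , refl , [] , nothing
firstZero-split (zero ∷ t)  = [] , zero ∷ t , refl , [] , just refl
firstZero-split (suc y ∷ t) with firstZero-split t
... | u , v , refl , u>0 , v₀ = suc y ∷ u , v , refl , s≤s z≤n ∷ u>0 , v₀

catalan-firstReturn : CatalanWord w → w ≢ [] →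
  ∃₂ λ w₁ w₂ → w ≡ shift w₁ ++ w₂ × CatalanWord w₁ × CatalanWord w₂
catalan-firstReturn {[]}    _          w≢[] = ⊥-elim (w≢[] refl)
catalan-firstReturn {_ ∷ t} (refl , s) _ with firstZero-split t
... | u , v , refl , u>0 , v₀ with catalan-shift⁻ (steps-++⁻ˡ 0 u s) u>0
...   | w₁ , refl , cw₁ = w₁ , v , refl , cw₁ , catalan-++⁻ʳ (0 ∷ u) v₀ (refl , s)

lastZero-injective : ∀ u₁ u₂ {z₁ z₂} → AllPositive z₁ → AllPositive z₂ →
  u₁ ++ 0 ∷ z₁ ≡ u₂ ++ 0 ∷ z₂ → u₁ ≡ u₂
lastZero-injective []       []       _    _    _    = refl
lastZero-injective []       (_ ∷ u₂) z₁>0 _    refl = ⊥-elim (¬allPositive-0 u₂ z₁>0)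
lastZero-injective (_ ∷ u₁) []       _    z₂>0 refl = ⊥-elim (¬allPositive-0 u₁ z₂>0)
lastZero-injective (x ∷ u₁) (y ∷ u₂) z₁>0 z₂>0 e with ∷-injective e
... | refl , e′ = cong (x ∷_) (lastZero-injective u₁ u₂ z₁>0 z₂>0 e′)

firstZero-injective : ∀ u₁ u₂ {v₁ v₂} → AllPositive u₁ → AllPositive u₂ → HeadZero v₁ → HeadZero v₂ →
  u₁ ++ v₁ ≡ u₂ ++ v₂ → v₁ ≡ v₂
firstZero-injective []       []       _          _          _         _         e = e
firstZero-injective []       (_ ∷ _)  {_ ∷ _} _ (x>0 ∷ _) (just refl) _ refl = ⊥-elim (n≮0 x>0)
firstZero-injective (_ ∷ _)  []       {_} {_ ∷ _} (x>0 ∷ _) _ _ (just refl) refl = ⊥-elim (n≮0 x>0)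
firstZero-injective (x ∷ u₁) (y ∷ u₂) (_ ∷ u₁>0) (_ ∷ u₂>0) v₁₀ v₂₀ e =
  firstZero-injective u₁ u₂ u₁>0 u₂>0 v₁₀ v₂₀ (proj₂ (∷-injective e))

record CountRecurrence (a : ℕ → ℕ) : Set where
  field
    initial₀ : a 0 ≡ 1
    initial₁ : a 1 ≡ 1
    step     : ∀ m → a (2 + m) + 1 ≡ 3 * a (1 + m)

record DescentRecurrence (d : ℕ → ℕ) : Set where
  field
    initial₀ : d 0 ≡ 0
    initial₁ : d 1 ≡ 0
    initial₂ : d 2 ≡ 0
    step     : ∀ m → d (3 + m) ≡ 3 * d (2 + m) + 3 ^ m

sumUpTo-vanishing : ∀ k (g : ℕ → ℤ) → (∀ i → g (3 + i) ≡ + 0) → sumUpTo (2 + k) g ≡ g 0 ℤ.+ g 1 ℤ.+ g 2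
sumUpTo-vanishing zero    g g≡0 = refl
sumUpTo-vanishing (suc k) g g≡0 = trans (cong₂ ℤ._+_ (sumUpTo-vanishing k g g≡0) (g≡0 k)) (ℤ.+-identityʳ _)

⊛-quadratic : ∀ (c₀ c₁ c₂ : ℤ) (f : ℕ → ℤ) k →
  (poly (c₀ ∷ c₁ ∷ c₂ ∷ []) ⊛ f) (2 + k) ≡ c₀ ℤ.* f (2 + k) ℤ.+ c₁ ℤ.* f (1 + k) ℤ.+ c₂ ℤ.* f k
⊛-quadratic c₀ c₁ c₂ f k = sumUpTo-vanishing k _ (λ _ → refl)

linear-combination≡0 : ∀ x y z k l → x + l * z ≡ k * y →
  + 1 ℤ.* + x ℤ.+ ℤ.- + k ℤ.* + y ℤ.+ + l ℤ.* + z ≡ + 0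
linear-combination≡0 x y z k l e = begin
  + 1 ℤ.* + x ℤ.+ ℤ.- + k ℤ.* + y ℤ.+ + l ℤ.* + z ≡⟨ rearrange (+ x) (+ y) (+ z) (+ k) (+ l) ⟩
  (+ x ℤ.+ + l ℤ.* + z) ℤ.- + k ℤ.* + y            ≡⟨ cong₂ ℤ._-_ x+lz (sym (ℤ.pos-* k y)) ⟩
  + (x + l * z) ℤ.- + (k * y)                      ≡⟨ cong (λ t → + t ℤ.- + (k * y)) e ⟩
  + (k * y) ℤ.- + (k * y)                          ≡⟨ ℤ.+-inverseʳ (+ (k * y)) ⟩
  + 0                                              ∎
  where
  open ≡-Reasoning
  rearrange : ∀ X Y Z K L → + 1 ℤ.* X ℤ.+ ℤ.- K ℤ.* Y ℤ.+ L ℤ.* Z ≡ (X ℤ.+ L ℤ.* Z) ℤ.- K ℤ.* Y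
  rearrange = ℤ-Solver.solve-∀
  x+lz : + x ℤ.+ + l ℤ.* + z ≡ + (x + l * z)
  x+lz = trans (cong (λ t → + x ℤ.+ t) (sym (ℤ.pos-* l z))) (sym (ℤ.pos-+ x (l * z)))

module _ {a : ℕ → ℕ} (rec : CountRecurrence a) where
  open CountRecurrence rec

  count-twice : ∀ m → 2 * a (suc m) ≡ 3 ^ m + 1
  count-twice zero    = cong (2 *_) initial₁
  count-twice (suc m) = +-cancelʳ-≡ 2 _ _ (begin
    2 * a (2 + m) + 2   ≡⟨ distrib (a (2 + m)) ⟩
    2 * (a (2 + m) + 1) ≡⟨ cong (2 *_) (step m) ⟩
    2 * (3 * a (1 + m)) ≡⟨ swap (a (1 + m)) ⟩
    3 * (2 * a (1 + m)) ≡⟨ cong (3 *_) (count-twice m) ⟩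
    3 * (3 ^ m + 1)     ≡⟨ distrib′ (3 ^ m) ⟩
    3 ^ suc m + 1 + 2   ∎)
    where
    open ≡-Reasoning
    distrib : ∀ t → 2 * t + 2 ≡ 2 * (t + 1)
    distrib = ℕ-Solver.solve-∀
    swap : ∀ t → 2 * (3 * t) ≡ 3 * (2 * t)
    swap = ℕ-Solver.solve-∀
    distrib′ : ∀ t → 3 * (t + 1) ≡ 3 * t + 1 + 2
    distrib′ = ℕ-Solver.solve-∀

  count-closed : ∀ n → 1 ≤ n → a n ≡ (3 ^ (n ∸ 1) + 1) / 2
  count-closed (suc m) _ = begin
    a (suc m)           ≡⟨ sym (m*n/n≡m (a (suc m)) 2) ⟩
    a (suc m) * 2 / 2   ≡⟨ cong (_/ 2) (trans (*-comm (a (suc m)) 2) (count-twice m)) ⟩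
    (3 ^ m + 1) / 2     ∎
    where open ≡-Reasoning

  private
    a₂ : a 2 ≡ 2
    a₂ = +-cancelʳ-≡ 1 _ _ (trans (step 0) (cong (3 *_) initial₁))

    three-term : ∀ m → a (3 + m) + 3 * a (1 + m) ≡ 4 * a (2 + m)
    three-term m = +-cancelʳ-≡ 1 _ _ (begin
      a (3 + m) + 3 * a (1 + m) + 1   ≡⟨ shuffle (a (3 + m)) (a (1 + m)) ⟩
      (a (3 + m) + 1) + 3 * a (1 + m) ≡⟨ cong₂ _+_ (step (1 + m)) (sym (step m)) ⟩
      3 * a (2 + m) + (a (2 + m) + 1) ≡⟨ collect (a (2 + m)) ⟩
      4 * a (2 + m) + 1               ∎)
      where
      open ≡-Reasoning
      shuffle : ∀ s t → s + 3 * t + 1 ≡ (s + 1) + 3 * t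
      shuffle = ℕ-Solver.solve-∀
      collect : ∀ t → 3 * t + (t + 1) ≡ 4 * t + 1
      collect = ℕ-Solver.solve-∀

  count-gf : ∀ n → (poly (+ 1 ∷ -[1+ 3 ] ∷ + 3 ∷ []) ⊛ (λ m → + a m)) n ≡ poly (+ 1 ∷ -[1+ 2 ] ∷ + 1 ∷ []) n
  count-gf zero          rewrite initial₀ = refl
  count-gf (suc zero)    rewrite initial₀ | initial₁ = refl
  count-gf (suc (suc k)) = trans (⊛-quadratic (+ 1) -[1+ 3 ] (+ 3) (λ m → + a m) k) (coefficient k)
    where
    coefficient : ∀ k → + 1 ℤ.* + a (2 + k) ℤ.+ -[1+ 3 ] ℤ.* + a (1 + k) ℤ.+ + 3 ℤ.* + a k
                      ≡ poly (+ 1 ∷ -[1+ 2 ] ∷ + 1 ∷ []) (2 + k)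
    coefficient zero    rewrite a₂ | initial₁ | initial₀ = refl
    coefficient (suc k) = linear-combination≡0 (a (3 + k)) (a (2 + k)) (a (1 + k)) 4 3 (three-term k)

module _ {d : ℕ → ℕ} (rec : DescentRecurrence d) where
  open DescentRecurrence rec

  private
    descents-from-3 : ∀ m → d (3 + m) ≡ suc m * 3 ^ m
    descents-from-3 zero    rewrite step 0 | initial₂ = refl
    descents-from-3 (suc m) = begin
      d (4 + m)                        ≡⟨ step (1 + m) ⟩
      3 * d (3 + m) + 3 ^ suc m        ≡⟨ cong (λ t → 3 * t + 3 ^ suc m) (descents-from-3 m) ⟩
      3 * (suc m * 3 ^ m) + 3 ^ suc m  ≡⟨ collect m (3 ^ m) ⟩
      suc (suc m) * 3 ^ suc m          ∎
      where
      open ≡-Reasoning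
      collect : ∀ m p → 3 * (suc m * p) + 3 * p ≡ suc (suc m) * (3 * p)
      collect = ℕ-Solver.solve-∀

    three-term : ∀ m → d (4 + m) + 9 * d (2 + m) ≡ 6 * d (3 + m)
    three-term m rewrite step (1 + m) | step m = collect (d (2 + m)) (3 ^ m)
      where
      collect : ∀ s p → 3 * (3 * s + p) + 3 * p + 9 * s ≡ 6 * (3 * s + p)
      collect = ℕ-Solver.solve-∀

  descents-closed : ∀ n → 2 ≤ n → d n ≡ (n ∸ 2) * 3 ^ (n ∸ 3)
  descents-closed (suc zero)          (s≤s ())
  descents-closed (suc (suc zero))    _ = initial₂
  descents-closed (suc (suc (suc m))) _ = descents-from-3 m

  descents-gf : ∀ n → (poly (+ 1 ∷ -[1+ 5 ] ∷ + 9 ∷ []) ⊛ (λ m → + d m)) n ≡ poly (+ 0 ∷ + 0 ∷ + 0 ∷ + 1 ∷ []) n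
  descents-gf zero          rewrite initial₀ = refl
  descents-gf (suc zero)    rewrite initial₀ | initial₁ = refl
  descents-gf (suc (suc k)) = trans (⊛-quadratic (+ 1) -[1+ 5 ] (+ 9) (λ m → + d m) k) (coefficient k)
    where
    coefficient : ∀ k → + 1 ℤ.* + d (2 + k) ℤ.+ -[1+ 5 ] ℤ.* + d (1 + k) ℤ.+ + 9 ℤ.* + d k
                      ≡ poly (+ 0 ∷ + 0 ∷ + 0 ∷ + 1 ∷ []) (2 + k)
    coefficient zero          rewrite initial₂ | initial₁ | initial₀ = refl
    coefficient (suc zero)    rewrite descents-from-3 0 | initial₂ | initial₁ = refl
    coefficient (suc (suc k)) = linear-combination≡0 (d (4 + k)) (d (3 + k)) (d (2 + k)) 6 9 (three-term k)

total : (List ℕ → ℕ) → List (List ℕ) → ℕ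
total f ws = sum (map f ws)

total-++ : ∀ f (ws vs : List (List ℕ)) → total f (ws ++ vs) ≡ total f ws + total f vs
total-++ f ws vs = trans (cong sum (map-++ f ws vs)) (sum-++ (map f ws) (map f vs))

total-map : ∀ f g (ws : List (List ℕ)) → total f (map g ws) ≡ total (f ∘ g) ws
total-map f g ws = cong sum (sym (map-∘ ws))

total-map-++ : ∀ h (f g : List ℕ → List ℕ) xs ys →
  total h (map f xs ++ map g ys) ≡ total (h ∘ f) xs + total (h ∘ g) ys
total-map-++ h f g xs ys = trans (total-++ h (map f xs) (map g ys)) (cong₂ _+_ (total-map h f xs) (total-map h g ys))

total-cong : ∀ {f g} ws → (∀ {w} → w ∈ ws → f w ≡ g w) → total f ws ≡ total g ws
total-cong ws f≡g = cong sum (map-cong-local (All.tabulate f≡g))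

total-+ : ∀ f g ws → total (λ w → f w + g w) ws ≡ total f ws + total g ws
total-+ f g []       = refl
total-+ f g (w ∷ ws) = trans (cong (λ t → f w + g w + t) (total-+ f g ws)) (interchange (f w) (g w) _ _)
  where
  interchange : ∀ a b c d → a + b + (c + d) ≡ a + c + (b + d)
  interchange = ℕ-Solver.solve-∀

total-1 : ∀ {f} ws → (∀ {w} → w ∈ ws → f w ≡ 1) → total f ws ≡ length ws
total-1 []       _    = refl
total-1 (w ∷ ws) f≡1 = cong₂ _+_ (f≡1 (here refl)) (total-1 ws (f≡1 ∘ there))

total-0 : ∀ {f} ws → (∀ {w} → w ∈ ws → f w ≡ 0) → total f ws ≡ 0
total-0 []       _    = refl
total-0 (w ∷ ws) f≡0 = cong₂ _+_ (f≡0 (here refl)) (total-0 ws (f≡0 ∘ there))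

des-0∷ : ∀ v → des (0 ∷ v) ≡ des v
des-0∷ []      = refl
des-0∷ (_ ∷ _) = refl

des-map-suc : ∀ v → des (map suc v) ≡ des v
des-map-suc []          = refl
des-map-suc (x ∷ [])    = refl
des-map-suc (x ∷ y ∷ v) = cong (λ d → if y <ᵇ x then suc d else d) (des-map-suc (y ∷ v))

des-shift : ∀ v → des (shift v) ≡ des v
des-shift v = trans (des-0∷ (map suc v)) (des-map-suc v)

des-zeros : ∀ n → des (zeros n) ≡ 0
des-zeros zero          = refl
des-zeros (suc zero)    = refl
des-zeros (suc (suc n)) = des-zeros (suc n)

-- lastExceeds x v is the number of descents created by appending x to v.
lastExceeds : ℕ → List ℕ → ℕ
lastExceeds x []          = 0
lastExceeds x (y ∷ [])    = if x <ᵇ y then 1 else 0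
lastExceeds x (_ ∷ y ∷ v) = lastExceeds x (y ∷ v)

des-snoc : ∀ v x → des (v ++ [ x ]) ≡ des v + lastExceeds x v
des-snoc []          x = refl
des-snoc (y ∷ [])    x = refl
des-snoc (y ∷ z ∷ v) x = trans (cong (λ d → if z <ᵇ y then suc d else d) (des-snoc (z ∷ v) x))
                               (if-suc-+ (z <ᵇ y))
  where
  if-suc-+ : ∀ b {d e} → (if b then suc (d + e) else d + e) ≡ (if b then suc d else d) + e
  if-suc-+ true  = refl
  if-suc-+ false = refl

lastExceeds-snoc : ∀ v x y → lastExceeds x (v ++ [ y ]) ≡ (if x <ᵇ y then 1 else 0)
lastExceeds-snoc []          x y = refl
lastExceeds-snoc (_ ∷ [])    x y = refl
lastExceeds-snoc (_ ∷ z ∷ v) x y = lastExceeds-snoc (z ∷ v) x y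

lastExceeds-++ : ∀ u {v} x → v ≢ [] → lastExceeds x (u ++ v) ≡ lastExceeds x v
lastExceeds-++ []          x _    = refl
lastExceeds-++ (_ ∷ [])    {[]}    x v≢[] = ⊥-elim (v≢[] refl)
lastExceeds-++ (_ ∷ [])    {_ ∷ _} x _    = refl
lastExceeds-++ (_ ∷ y ∷ u) x v≢[] = lastExceeds-++ (y ∷ u) x v≢[]

lastExceeds-≤ : All (_≤ x) v → lastExceeds x v ≡ 0
lastExceeds-≤ []               = refl
lastExceeds-≤ (y≤x ∷ [])       = cong (λ b → if b then 1 else 0) (≤⇒<ᵇ≡false y≤x)
  where
  ≤⇒<ᵇ≡false : ∀ {x y} → y ≤ x → (x <ᵇ y) ≡ false
  ≤⇒<ᵇ≡false z≤n       = refl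
  ≤⇒<ᵇ≡false (s≤s y≤x) = ≤⇒<ᵇ≡false y≤x
lastExceeds-≤ (_ ∷ y≤x ∷ all≤) = lastExceeds-≤ (y≤x ∷ all≤)

lastExceeds-map-suc : ∀ a t → lastExceeds 0 (map suc (a ∷ t)) ≡ 1
lastExceeds-map-suc a []      = refl
lastExceeds-map-suc a (b ∷ t) = lastExceeds-map-suc b t

consZeros : ℕ → List (List ℕ) → List (List ℕ)
consZeros zero    ws = ws
consZeros (suc m) ws = zeros (suc m) ∷ ws

NonConstant NonEmpty : (ℕ → ℕ → ℕ → Set) → List ℕ → Set
NonConstant R w = CatalanWord w × ¬ Occurs R w × ¬ AllZero w
NonEmpty    R w = CatalanWord w × ¬ Occurs R w × w ≢ []

nonConstant-head : ∀ {R} → NonConstant R w → ∃ λ t → w ≡ 0 ∷ t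
nonConstant-head (c , _ , w≢0) = catalan-head c (λ { refl → w≢0 [] })

Enumerates : (List ℕ → Set) → List (List ℕ) → ℕ → Set
Enumerates P ws n = ∀ w → (w ∈ ws) ⇔ (P w × length w ≡ n)

record Enumeration (P : List ℕ → Set) : Set where
  field
    words    : ℕ → List (List ℕ)
    unique   : ∀ n → Unique (words n)
    members  : ∀ n w → (w ∈ words n) ⇔ (CatalanWord w × length w ≡ n × P w)
    count    : CountRecurrence (λ n → length (words n))
    descents : DescentRecurrence (λ n → total des (words n))

enumeration-⇔ : ∀ {P Q} → (∀ {w} → P w ⇔ Q w) → Enumeration P → Enumeration Q
enumeration-⇔ P⇔Q e = record
  { words = words ; unique = unique ; count = count ; descents = descents
  ; members = λ n w → mk⇔
      (λ w∈ → let c , l , p = to (members n w) w∈ in c , l , to P⇔Q p)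
      (λ (c , l , q) → from (members n w) (c , l , from P⇔Q q)) }
  where open Enumeration e
        open Equivalence

module TwoClassEnumeration
  {R : ℕ → ℕ → ℕ → Set} (never-0 : NeverFirst {R} 0)
  {GoodX GoodY : List ℕ → Set}
  (goodX⇒ : ∀ {w} → GoodX w → NonConstant R w)
  (goodY⇒ : ∀ {w} → GoodY w → NonConstant R w)
  (⇒good : ∀ {w} → NonConstant R w → GoodX w ⊎ GoodY w)
  (good-disjoint : ∀ {w} → GoodX w → GoodY w → ⊥)
  (X Y : ℕ → List (List ℕ))
  where

  nonConstant nonEmpty : ℕ → List (List ℕ)
  nonConstant n = X n ++ Y n
  nonEmpty    n = consZeros n (nonConstant n)

  Classified : ℕ → Set
  Classified n = Enumerates GoodX (X n) n × Enumerates GoodY (Y n) n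

  avoids-zeros : ∀ n → ¬ Occurs R (zeros n)
  avoids-zeros n = subst (λ w → ¬ Occurs R w) (++-identityʳ (zeros n))
    (avoids-++-neverFirst (All.replicate⁺ n never-0) avoids-[])

  nonConstant-enumerates : ∀ {n} → Classified n → Enumerates (NonConstant R) (nonConstant n) n
  nonConstant-enumerates {n} (enumX , enumY) w = mk⇔ to from
    where
    to : w ∈ nonConstant n → NonConstant R w × length w ≡ n
    to w∈ with ∈-++⁻ (X n) w∈
    ... | inj₁ w∈X = Product.map₁ goodX⇒ (Equivalence.to (enumX w) w∈X)
    ... | inj₂ w∈Y = Product.map₁ goodY⇒ (Equivalence.to (enumY w) w∈Y)
    from : NonConstant R w × length w ≡ n → w ∈ nonConstant n
    from (nc , l) with ⇒good nc
    ... | inj₁ gx = ∈-++⁺ˡ (Equivalence.from (enumX w) (gx , l))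
    ... | inj₂ gy = ∈-++⁺ʳ (X n) (Equivalence.from (enumY w) (gy , l))

  nonEmpty-enumerates : ∀ {n} → Classified n → Enumerates (NonEmpty R) (nonEmpty n) n
  nonEmpty-enumerates {zero}  classified w = mk⇔
    (λ w∈ → let (_ , _ , w≢0) , l = Equivalence.to (nonConstant-enumerates classified w) w∈
            in ⊥-elim (w≢0 (subst AllZero (sym (length≡0⇒[] w l)) [])))
    (λ ((_ , _ , w≢[]) , l) → ⊥-elim (w≢[] (length≡0⇒[] w l)))
  nonEmpty-enumerates {suc m} classified w = mk⇔ to from
    where
    enumNC : (w ∈ nonConstant (suc m)) ⇔ (NonConstant R w × length w ≡ suc m)
    enumNC = nonConstant-enumerates classified w
    to : w ∈ nonEmpty (suc m) → NonEmpty R w × length w ≡ suc m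
    to (here refl) = (catalan-zeros (suc m) , avoids-zeros (suc m) , λ ()) , length-replicate (suc m)
    to (there w∈) with Equivalence.to enumNC w∈
    ... | (c , av , w≢0) , l = (c , av , λ { refl → w≢0 [] }) , l
    from : NonEmpty R w × length w ≡ suc m → w ∈ nonEmpty (suc m)
    from ((c , av , w≢[]) , l) with allZero? w
    ... | yes w≡0 = here (trans (allZero⇒zeros w≡0) (cong zeros l))
    ... | no  w≢0 = there (Equivalence.from enumNC ((c , av , w≢0) , l))

  nonConstant-unique : ∀ {n} → Classified n → Unique (X n) → Unique (Y n) → Unique (nonConstant n)
  nonConstant-unique (enumX , enumY) uX uY = Unique.++⁺ uX uY λ (w∈X , w∈Y) →
    good-disjoint (proj₁ (Equivalence.to (enumX _) w∈X)) (proj₁ (Equivalence.to (enumY _) w∈Y))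

  nonEmpty-unique : ∀ {n} → Classified n → Unique (X n) → Unique (Y n) → Unique (nonEmpty n)
  nonEmpty-unique {zero}  = nonConstant-unique
  nonEmpty-unique {suc m} classified uX uY =
    All.tabulate (λ w∈ zeros≡w → proj₂ (proj₂ (nonConstant⇒ w∈)) (subst AllZero zeros≡w (All.replicate⁺ (suc m) refl)))
    ∷ nonConstant-unique classified uX uY
    where
    nonConstant⇒ : ∀ {w} → w ∈ nonConstant (suc m) → NonConstant R w
    nonConstant⇒ w∈ = proj₁ (Equivalence.to (nonConstant-enumerates classified _) w∈)

  nonEmpty-descents : ∀ n → total des (nonEmpty n) ≡ total des (nonConstant n)
  nonEmpty-descents zero    = refl
  nonEmpty-descents (suc m) = cong (_+ total des (nonConstant (suc m))) (des-zeros (suc m))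

  module Counted
    (classified : ∀ n → Classified n)
    (unique : ∀ n → Unique (X n) × Unique (Y n))
    (nonConstant₁ : length (nonConstant 1) ≡ 0)
    (nonConstant-step : ∀ n → length (nonConstant (suc n)) ≡ length (nonConstant n) + length (nonConstant n) + length (nonEmpty n))
    (extra : ℕ → ℕ)
    (descents₁ : total des (nonConstant 1) ≡ 0)
    (descents₂ : total des (nonConstant 2) ≡ 0)
    (descents-step : ∀ n → total des (nonConstant (suc n)) ≡ 3 * total des (nonConstant n) + extra n)
    (extra-step : ∀ n → extra (suc n) ≡ length (nonConstant n) + length (nonEmpty n))
    where

    avoiders : ℕ → List (List ℕ)
    avoiders zero    = [ [] ]
    avoiders (suc m) = nonEmpty (suc m)

    avoiders-unique : ∀ n → Unique (avoiders n)
    avoiders-unique zero    = [] ∷ []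
    avoiders-unique (suc m) = nonEmpty-unique (classified (suc m)) (proj₁ (unique (suc m))) (proj₂ (unique (suc m)))

    avoiders-members : ∀ n w → (w ∈ avoiders n) ⇔ (CatalanWord w × length w ≡ n × ¬ Occurs R w)
    avoiders-members zero    w = mk⇔ (λ { (here refl) → tt , refl , avoids-[] })
                                     (λ { (_ , l , _) → here (length≡0⇒[] w l) })
    avoiders-members (suc m) w = mk⇔
      (λ w∈ → let (c , av , _) , l = Equivalence.to enumNE w∈ in c , l , av)
      (λ (c , l , av) → Equivalence.from enumNE ((c , av , λ { refl → 0≢1+n l }) , l))
      where
      enumNE : (w ∈ nonEmpty (suc m)) ⇔ (NonEmpty R w × length w ≡ suc m)
      enumNE = nonEmpty-enumerates (classified (suc m)) w

    count : CountRecurrence (λ n → length (avoiders n))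
    count = record
      { initial₀ = refl
      ; initial₁ = cong suc nonConstant₁
      ; step     = λ m → trans (cong (λ t → suc t + 1) (nonConstant-step (suc m))) (triple (length (nonConstant (suc m))))
      }
      where
      triple : ∀ t → suc (t + t + suc t) + 1 ≡ 3 * suc t
      triple = ℕ-Solver.solve-∀

    extra-closed : ∀ m → extra (2 + m) ≡ 3 ^ m
    extra-closed m = +-cancelʳ-≡ 1 _ _ (begin
      extra (2 + m) + 1 ≡⟨ cong (_+ 1) (extra-step (suc m)) ⟩
      t + suc t + 1     ≡⟨ double t ⟩
      2 * suc t         ≡⟨ count-twice count m ⟩
      3 ^ m + 1         ∎)
      where
      open ≡-Reasoning
      t : ℕ
      t = length (nonConstant (suc m))
      double : ∀ t → t + suc t + 1 ≡ 2 * suc t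
      double = ℕ-Solver.solve-∀

    descents : DescentRecurrence (λ n → total des (avoiders n))
    descents = record
      { initial₀ = refl
      ; initial₁ = trans (nonEmpty-descents 1) descents₁
      ; initial₂ = trans (nonEmpty-descents 2) descents₂
      ; step     = λ m → begin
          total des (avoiders (3 + m))                        ≡⟨ nonEmpty-descents (3 + m) ⟩
          total des (nonConstant (3 + m))                     ≡⟨ descents-step (2 + m) ⟩
          3 * total des (nonConstant (2 + m)) + extra (2 + m) ≡⟨ cong₂ (λ d e → 3 * d + e)
                                                                   (sym (nonEmpty-descents (2 + m))) (extra-closed m) ⟩
          3 * total des (avoiders (2 + m)) + 3 ^ m            ∎
      }
      where open ≡-Reasoning

    enumeration : Enumeration (λ w → ¬ Occurs R w)
    enumeration = record
      { words = avoiders ; unique = avoiders-unique ; members = avoiders-members ; count = count ; descents = descents }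

module Avoid102 where

  shape-suc : Shape102 a b c → Shape102 (suc a) (suc b) (suc c)
  shape-suc (b<a , a<c) = s≤s b<a , s≤s a<c

  shape-pred : Shape102 (suc a) (suc b) (suc c) → Shape102 a b c
  shape-pred (b<a , a<c) = s≤s⁻¹ b<a , s≤s⁻¹ a<c

  never-first-0 : NeverFirst {Shape102} 0
  never-first-0 (b<0 , _) = n≮0 b<0

  never-last-≤1 : c ≤ 1 → NeverLast {Shape102} c
  never-last-≤1 c≤1 (b<a , a<c) = n≮0 (<-≤-trans b<a (s≤s⁻¹ (<-≤-trans a<c c≤1)))

  -- Split at the last 0: X-words have only zeros before it, Y-words have only ones after it.
  GoodX GoodY : List ℕ → Set
  GoodX w = ∃₂ λ j w₂ → w ≡ zeros j ++ shift w₂ × NonEmpty Shape102 w₂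
  GoodY w = ∃₂ λ k w₁ → w ≡ w₁ ++ 0 ∷ ones k × NonConstant Shape102 w₁

  goodX⇒ : GoodX w → NonConstant Shape102 w
  goodX⇒ (j , w₂ , refl , c₂ , av₂ , w₂≢[]) =
    catalan-++ (zeros j) (catalan-zeros j) (catalan-shift c₂) ,
    avoids-++-neverFirst (All.replicate⁺ j never-first-0) (avoids-shift never-first-0 shape-pred av₂) ,
    ¬allZero-shift w₂≢[] ∘ All.++⁻ʳ (zeros j)

  goodY⇒ : GoodY w → NonConstant Shape102 w
  goodY⇒ (k , w₁ , refl , c₁ , av₁ , w₁≢0) =
    catalan-++ w₁ c₁ (catalan-ones k) ,
    avoids-++-neverLast av₁ (All.map never-last-≤1 (≤1-ones k)) ,
    w₁≢0 ∘ All.++⁻ˡ w₁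

  both-nonConstant⇒occurs : CatalanWord w₁ → CatalanWord w₂ → ¬ AllZero w₁ → ¬ AllZero w₂ →
    Occurs Shape102 (w₁ ++ shift w₂)
  both-nonConstant⇒occurs c₁ c₂ w₁≢0 w₂≢0 =
    1 , 0 , 2 , Sublist.++⁺ (catalan-¬allZero⇒1 c₁ w₁≢0) (refl ∷ Sublist.map⁺ suc (catalan-¬allZero⇒1 c₂ w₂≢0)) ,
    0<1 , 1<2

  ⇒good : NonConstant Shape102 w → GoodX w ⊎ GoodY w
  ⇒good (c , av , w≢0) with catalan-lastZero c (λ { refl → w≢0 [] })
  ... | w₁ , w₂ , refl , c₁ , c₂ with allZero? w₁ | allZero? w₂
  ... | yes w₁≡0 | _ = inj₁ (length w₁ , w₂ , cong (_++ shift w₂) (allZero⇒zeros w₁≡0) ,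
          c₂ , avoids-++⁻ʳ [ 0 ] (avoids-++⁻ʳ w₁ av) ∘ occurs-map-suc shape-suc ,
          λ { refl → w≢0 (All.++⁺ w₁≡0 (refl ∷ [])) })
  ... | no w₁≢0 | yes w₂≡0 = inj₂ (length w₂ , w₁ ,
          cong (λ t → w₁ ++ 0 ∷ t) (trans (cong (map suc) (allZero⇒zeros w₂≡0)) (map-replicate suc _ 0)) ,
          c₁ , avoids-++⁻ˡ w₁ av , w₁≢0)
  ... | no w₁≢0 | no w₂≢0 = ⊥-elim (av (both-nonConstant⇒occurs c₁ c₂ w₁≢0 w₂≢0))

  good-disjoint : GoodX w → GoodY w → ⊥
  good-disjoint (j , w₂ , e₂ , _) (k , w₁ , e₁ , _ , _ , w₁≢0) =
    w₁≢0 (subst AllZero zeros≡w₁ (All.replicate⁺ j refl))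
    where
    zeros≡w₁ : zeros j ≡ w₁
    zeros≡w₁ = lastZero-injective (zeros j) w₁ (allPositive-map-suc w₂) (All.replicate⁺ k (s≤s z≤n)) (trans (sym e₂) e₁)

  step : ℕ → List (List ℕ) × List (List ℕ) → List (List ℕ) × List (List ℕ)
  step n (xs , ys) = map (0 ∷_) xs ++ map shift (consZeros n (xs ++ ys)) , map (_++ [ 1 ]) ys ++ map (_++ [ 0 ]) (xs ++ ys)

  generate : ℕ → List (List ℕ) × List (List ℕ)
  generate zero    = [] , []
  generate (suc n) = step n (generate n)

  X Y : ℕ → List (List ℕ)
  X n = proj₁ (generate n)
  Y n = proj₂ (generate n)

  open TwoClassEnumeration never-first-0 goodX⇒ goodY⇒ ⇒good good-disjoint X Y

  extend-ones : ∀ w₁ k → (w₁ ++ 0 ∷ ones k) ++ [ 1 ] ≡ w₁ ++ 0 ∷ ones (suc k)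
  extend-ones w₁ k = trans (++-assoc w₁ (0 ∷ ones k) [ 1 ]) (cong (λ t → w₁ ++ 0 ∷ t) (replicate-snoc k 1))

  X-step : ∀ {n} → Classified n → Enumerates GoodX (X (suc n)) (suc n)
  X-step {n} classified@(enumX , _) w = mk⇔ to from
    where
    enumNE : Enumerates (NonEmpty Shape102) (nonEmpty n) n
    enumNE = nonEmpty-enumerates classified
    to : w ∈ X (suc n) → GoodX w × length w ≡ suc n
    to w∈ with ∈-++⁻ (map (0 ∷_) (X n)) w∈
    ... | inj₁ w∈₁ with ∈-map⁻ (0 ∷_) w∈₁
    ...   | v , v∈ , refl with Equivalence.to (enumX v) v∈
    ...     | (j , w₂ , refl , ne₂) , l = (suc j , w₂ , refl , ne₂) , cong suc l
    to w∈ | inj₂ w∈₂ with ∈-map⁻ shift w∈₂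
    ...   | u , u∈ , refl with Equivalence.to (enumNE u) u∈
    ...     | ne , l = (0 , u , refl , ne) , cong suc (trans (length-map suc u) l)
    from : GoodX w × length w ≡ suc n → w ∈ X (suc n)
    from ((zero , w₂ , refl , ne₂) , l) = ∈-++⁺ʳ (map (0 ∷_) (X n)) (∈-map⁺ shift
      (Equivalence.from (enumNE w₂) (ne₂ , trans (sym (length-map suc w₂)) (suc-injective l))))
    from ((suc j , w₂ , refl , ne₂) , l) = ∈-++⁺ˡ (∈-map⁺ (0 ∷_)
      (Equivalence.from (enumX _) ((j , w₂ , refl , ne₂) , suc-injective l)))

  Y-step : ∀ {n} → Classified n → Enumerates GoodY (Y (suc n)) (suc n)
  Y-step {n} classified@(_ , enumY) w = mk⇔ to from
    where
    enumNC : Enumerates (NonConstant Shape102) (nonConstant n) n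
    enumNC = nonConstant-enumerates classified
    to : w ∈ Y (suc n) → GoodY w × length w ≡ suc n
    to w∈ with ∈-++⁻ (map (_++ [ 1 ]) (Y n)) w∈
    ... | inj₁ w∈₁ with ∈-map⁻ (_++ [ 1 ]) w∈₁
    ...   | v , v∈ , refl with Equivalence.to (enumY v) v∈
    ...     | (k , w₁ , refl , nc₁) , l =
              (suc k , w₁ , extend-ones w₁ k , nc₁) , trans (length-snoc (w₁ ++ 0 ∷ ones k) 1) (cong suc l)
    to w∈ | inj₂ w∈₂ with ∈-map⁻ (_++ [ 0 ]) w∈₂
    ...   | u , u∈ , refl with Equivalence.to (enumNC u) u∈
    ...     | nc , l = (0 , u , refl , nc) , trans (length-snoc u 0) (cong suc l)
    from : GoodY w × length w ≡ suc n → w ∈ Y (suc n)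
    from ((zero , w₁ , refl , nc₁) , l) = ∈-++⁺ʳ (map (_++ [ 1 ]) (Y n)) (∈-map⁺ (_++ [ 0 ])
      (Equivalence.from (enumNC w₁) (nc₁ , suc-injective (trans (sym (length-snoc w₁ 0)) l))))
    from ((suc k , w₁ , refl , nc₁) , l) = subst (_∈ Y (suc n)) (extend-ones w₁ k) (∈-++⁺ˡ (∈-map⁺ (_++ [ 1 ])
      (Equivalence.from (enumY _) ((k , w₁ , refl , nc₁) ,
        suc-injective (trans (sym (length-snoc (w₁ ++ 0 ∷ ones k) 1)) (trans (cong length (extend-ones w₁ k)) l))))))

  classified : ∀ n → Classified n
  classified zero    = (λ w → mk⇔ (λ ()) λ { ((j , w₂ , refl , _) , l) → ⊥-elim (0≢1+n (trans (sym l) (length-++-sucʳ (zeros j) 0 _))) })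
                     , (λ w → mk⇔ (λ ()) λ { ((k , w₁ , refl , _) , l) → ⊥-elim (0≢1+n (trans (sym l) (length-++-sucʳ w₁ 0 _))) })
  classified (suc n) = X-step (classified n) , Y-step (classified n)

  goodX : ∀ {n w} → w ∈ X n → GoodX w
  goodX {n} w∈ = proj₁ (Equivalence.to (proj₁ (classified n) _) w∈)

  goodY : ∀ {n w} → w ∈ Y n → GoodY w
  goodY {n} w∈ = proj₁ (Equivalence.to (proj₂ (classified n) _) w∈)

  unique : ∀ n → Unique (X n) × Unique (Y n)
  unique zero    = [] , []
  unique (suc n) with unique n
  ... | uX , uY =
    unique-map-++ ∷-injectiveʳ (map-injective suc-injective ∘ ∷-injectiveʳ) X≢shift uX (nonEmpty-unique (classified n) uX uY) ,
    unique-map-++ (∷ʳ-injectiveˡ _ _) (∷ʳ-injectiveˡ _ _) (λ _ _ e → 1≢0 (∷ʳ-injectiveʳ _ _ e)) uY (nonConstant-unique (classified n) uX uY)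
    where
    1≢0 : 1 ≢ 0
    1≢0 ()
    X≢shift : ∀ {v u} → v ∈ X n → u ∈ nonEmpty n → 0 ∷ v ≢ shift u
    X≢shift v∈ _ e with goodX⇒ (goodX {n} v∈) | ∷-injectiveʳ e
    ... | c , _ , v≢0 | refl with catalan-map-suc c
    ...   | refl = v≢0 []

  X-endsPositive : ∀ {n w} → w ∈ X n → lastExceeds 0 w ≡ 1
  X-endsPositive {n} w∈ with goodX {n} w∈
  ... | j , [] , refl , _ , _ , w₂≢[] = ⊥-elim (w₂≢[] refl)
  ... | j , a ∷ t , refl , _ =
    trans (lastExceeds-++ (zeros j) 0 (λ ())) (lastExceeds-map-suc a t)

  Y-endsLow : ∀ {n w} → w ∈ Y n → lastExceeds 1 w ≡ 0
  Y-endsLow {n} w∈ with goodY {n} w∈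
  ... | k , w₁ , refl , _ = trans (lastExceeds-++ w₁ 1 (λ ())) (lastExceeds-≤ (≤1-ones k))

  nonConstant-step : ∀ n → length (nonConstant (suc n)) ≡ length (nonConstant n) + length (nonConstant n) + length (nonEmpty n)
  nonConstant-step n = begin
    length (X (suc n) ++ Y (suc n))         ≡⟨ length-++ (X (suc n)) ⟩
    length (X (suc n)) + length (Y (suc n)) ≡⟨ cong₂ _+_ (length-map-++ (0 ∷_) shift (X n) (nonEmpty n))
                                                         (length-map-++ (_++ [ 1 ]) (_++ [ 0 ]) (Y n) (nonConstant n)) ⟩
    nX + nE + (nY + length (X n ++ Y n))    ≡⟨ cong (λ t → nX + nE + (nY + t)) (length-++ (X n)) ⟩
    nX + nE + (nY + (nX + nY))              ≡⟨ rearrange nX nY nE ⟩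
    (nX + nY) + (nX + nY) + nE              ≡⟨ cong (λ t → t + t + nE) (sym (length-++ (X n))) ⟩
    length (nonConstant n) + length (nonConstant n) + nE ∎
    where
    open ≡-Reasoning
    nX nY nE : ℕ
    nX = length (X n)
    nY = length (Y n)
    nE = length (nonEmpty n)
    rearrange : ∀ x y e → x + e + (y + (x + y)) ≡ (x + y) + (x + y) + e
    rearrange = ℕ-Solver.solve-∀

  -- endsPositive n counts the non-constant avoiders of length n ending in a positive letter (among them all X-words).
  endsPositive : ℕ → ℕ
  endsPositive n = length (X n) + total (lastExceeds 0) (Y n)

  endsPositive-nonConstant : ∀ n → total (lastExceeds 0) (nonConstant n) ≡ endsPositive n
  endsPositive-nonConstant n = trans (total-++ (lastExceeds 0) (X n) (Y n))
    (cong (_+ total (lastExceeds 0) (Y n)) (total-1 (X n) (X-endsPositive {n})))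

  descents-step : ∀ n → total des (nonConstant (suc n)) ≡ 3 * total des (nonConstant n) + endsPositive n
  descents-step n = begin
    total des (X (suc n) ++ Y (suc n))            ≡⟨ total-++ des (X (suc n)) (Y (suc n)) ⟩
    total des (X (suc n)) + total des (Y (suc n)) ≡⟨ cong₂ _+_ X-descents Y-descents ⟩
    (dX + D) + (dY + (D + e))                     ≡⟨ cong (λ t → dX + t + (dY + (t + e))) (total-++ des (X n) (Y n)) ⟩
    (dX + (dX + dY)) + (dY + ((dX + dY) + e))     ≡⟨ rearrange dX dY e ⟩
    3 * (dX + dY) + e                             ≡⟨ cong (λ t → 3 * t + e) (sym (total-++ des (X n) (Y n))) ⟩
    3 * D + e                                     ∎
    where
    open ≡-Reasoning
    D dX dY e : ℕ
    D  = total des (nonConstant n)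
    dX = total des (X n)
    dY = total des (Y n)
    e  = endsPositive n
    rearrange : ∀ a b c → a + (a + b) + (b + (a + b + c)) ≡ 3 * (a + b) + c
    rearrange = ℕ-Solver.solve-∀
    X-descents : total des (X (suc n)) ≡ dX + D
    X-descents = trans (total-map-++ des (0 ∷_) shift (X n) (nonEmpty n))
      (cong₂ _+_ (total-cong (X n) (λ {w} _ → des-0∷ w))
                 (trans (total-cong (nonEmpty n) (λ {w} _ → des-shift w)) (nonEmpty-descents n)))
    append-1 : ∀ {w} → w ∈ Y n → des (w ++ [ 1 ]) ≡ des w
    append-1 {w} w∈ = trans (des-snoc w 1) (trans (cong (λ t → des w + t) (Y-endsLow {n} w∈)) (+-identityʳ (des w)))
    append-0 : total (λ w → des (w ++ [ 0 ])) (nonConstant n) ≡ D + e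
    append-0 = trans (total-cong (nonConstant n) (λ {w} _ → des-snoc w 0))
      (trans (total-+ des (lastExceeds 0) (nonConstant n)) (cong (λ t → D + t) (endsPositive-nonConstant n)))
    Y-descents : total des (Y (suc n)) ≡ dY + (D + e)
    Y-descents = trans (total-map-++ des (_++ [ 1 ]) (_++ [ 0 ]) (Y n) (nonConstant n))
      (cong₂ _+_ (total-cong (Y n) append-1) append-0)

  endsPositive-step : ∀ n → endsPositive (suc n) ≡ length (nonConstant n) + length (nonEmpty n)
  endsPositive-step n = begin
    length (X (suc n)) + total (lastExceeds 0) (Y (suc n))
      ≡⟨ cong₂ _+_ (length-map-++ (0 ∷_) shift (X n) (nonEmpty n)) Y-endsPositive ⟩
    length (X n) + length (nonEmpty n) + length (Y n)
      ≡⟨ rearrange (length (X n)) (length (nonEmpty n)) (length (Y n)) ⟩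
    length (X n) + length (Y n) + length (nonEmpty n)
      ≡⟨ cong (_+ length (nonEmpty n)) (sym (length-++ (X n))) ⟩
    length (nonConstant n) + length (nonEmpty n) ∎
    where
    open ≡-Reasoning
    rearrange : ∀ a b c → a + b + c ≡ a + c + b
    rearrange = ℕ-Solver.solve-∀
    Y-endsPositive : total (lastExceeds 0) (Y (suc n)) ≡ length (Y n)
    Y-endsPositive = trans (total-map-++ (lastExceeds 0) (_++ [ 1 ]) (_++ [ 0 ]) (Y n) (nonConstant n))
      (trans (cong₂ _+_ (total-1 (Y n) (λ {w} _ → lastExceeds-snoc w 0 1)) (total-0 (nonConstant n) (λ {w} _ → lastExceeds-snoc w 0 0)))
             (+-identityʳ (length (Y n))))

  open Counted classified unique refl nonConstant-step endsPositive refl refl descents-step endsPositive-step public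
    using (enumeration)

module Avoid201 where

  shape-suc : Shape201 a b c → Shape201 (suc a) (suc b) (suc c)
  shape-suc (b<c , c<a) = s≤s b<c , s≤s c<a

  shape-pred : Shape201 (suc a) (suc b) (suc c) → Shape201 a b c
  shape-pred (b<c , c<a) = s≤s⁻¹ b<c , s≤s⁻¹ c<a

  never-first-≤1 : a ≤ 1 → NeverFirst {Shape201} a
  never-first-≤1 a≤1 (b<c , c<a) = n≮0 (<-≤-trans b<c (s≤s⁻¹ (<-≤-trans c<a a≤1)))

  never-first-0 : NeverFirst {Shape201} 0
  never-first-0 = never-first-≤1 z≤n

  never-last-0 : NeverLast {Shape201} 0
  never-last-0 (b<0 , _) = n≮0 b<0

  -- Split at the first return to 0: X-words climb only to 1 before it, Y-words have only zeros after it.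
  GoodX GoodY : List ℕ → Set
  GoodX w = ∃₂ λ j w₂ → w ≡ 0 ∷ ones j ++ w₂ × NonConstant Shape201 w₂
  GoodY w = ∃₂ λ k w₁ → w ≡ shift w₁ ++ zeros k × NonEmpty Shape201 w₁

  goodX⇒ : GoodX w → NonConstant Shape201 w
  goodX⇒ (j , w₂ , refl , c₂ , av₂ , w₂≢0) =
    catalan-++ (0 ∷ ones j) (catalan-ones j) c₂ ,
    avoids-++-neverFirst (All.map never-first-≤1 (≤1-ones j)) av₂ ,
    w₂≢0 ∘ All.++⁻ʳ (0 ∷ ones j)

  goodY⇒ : GoodY w → NonConstant Shape201 w
  goodY⇒ (k , w₁ , refl , c₁ , av₁ , w₁≢[]) =
    catalan-++ (shift w₁) (catalan-shift c₁) (catalan-zeros k) ,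
    avoids-++-neverLast (avoids-shift never-first-0 shape-pred av₁) (All.replicate⁺ k never-last-0) ,
    ¬allZero-shift w₁≢[] ∘ All.++⁻ˡ (shift w₁)

  both-nonConstant⇒occurs : CatalanWord w₁ → CatalanWord w₂ → ¬ AllZero w₁ → ¬ AllZero w₂ →
    Occurs Shape201 (shift w₁ ++ w₂)
  both-nonConstant⇒occurs c₁ c₂ w₁≢0 w₂≢0 =
    2 , 0 , 1 , Sublist.++⁺ (0 ∷ʳ Sublist.map⁺ suc (catalan-¬allZero⇒1 c₁ w₁≢0)) (catalan-¬allZero c₂ w₂≢0) ,
    0<1 , 1<2

  ⇒good : NonConstant Shape201 w → GoodX w ⊎ GoodY w
  ⇒good (c , av , w≢0) with catalan-firstReturn c (λ { refl → w≢0 [] })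
  ... | w₁ , w₂ , refl , c₁ , c₂ with allZero? w₁ | allZero? w₂
  ... | _ | yes w₂≡0 = inj₂ (length w₂ , w₁ , cong (shift w₁ ++_) (allZero⇒zeros w₂≡0) ,
          c₁ , avoids-++⁻ʳ [ 0 ] (avoids-++⁻ˡ (shift w₁) av) ∘ occurs-map-suc shape-suc ,
          λ { refl → w≢0 (refl ∷ w₂≡0) })
  ... | yes w₁≡0 | no w₂≢0 = inj₁ (length w₁ , w₂ ,
          cong (λ t → 0 ∷ t ++ w₂) (trans (cong (map suc) (allZero⇒zeros w₁≡0)) (map-replicate suc _ 0)) ,
          c₂ , avoids-++⁻ʳ (shift w₁) av , w₂≢0)
  ... | no w₁≢0 | no w₂≢0 = ⊥-elim (av (both-nonConstant⇒occurs c₁ c₂ w₁≢0 w₂≢0))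

  good-disjoint : GoodX w → GoodY w → ⊥
  good-disjoint (j , w₂ , e₂ , c₂ , _ , w₂≢0) (k , w₁ , e₁ , _) =
    w₂≢0 (subst AllZero (sym w₂≡zeros) (All.replicate⁺ k refl))
    where
    w₂≡zeros : w₂ ≡ zeros k
    w₂≡zeros = firstZero-injective (ones j) (map suc w₁) (All.replicate⁺ j (s≤s z≤n)) (allPositive-map-suc w₁)
      (catalan-headZero c₂) (catalan-headZero (catalan-zeros k)) (∷-injectiveʳ (trans (sym e₂) e₁))

  insert1 : List ℕ → List ℕ
  insert1 []      = []
  insert1 (a ∷ r) = a ∷ 1 ∷ r

  step : ℕ → List (List ℕ) × List (List ℕ) → List (List ℕ) × List (List ℕ)
  step n (xs , ys) = map (0 ∷_) (xs ++ ys) ++ map insert1 xs , map (_++ [ 0 ]) ys ++ map shift (consZeros n (xs ++ ys))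

  generate : ℕ → List (List ℕ) × List (List ℕ)
  generate zero    = [] , []
  generate (suc n) = step n (generate n)

  X Y : ℕ → List (List ℕ)
  X n = proj₁ (generate n)
  Y n = proj₂ (generate n)

  open TwoClassEnumeration never-first-0 goodX⇒ goodY⇒ ⇒good good-disjoint X Y

  extend-zeros : ∀ w₁ k → (shift w₁ ++ zeros k) ++ [ 0 ] ≡ shift w₁ ++ zeros (suc k)
  extend-zeros w₁ k = trans (++-assoc (shift w₁) (zeros k) [ 0 ]) (cong (shift w₁ ++_) (replicate-snoc k 0))

  X-step : ∀ {n} → Classified n → Enumerates GoodX (X (suc n)) (suc n)
  X-step {n} classified@(enumX , _) w = mk⇔ to from
    where
    enumNC : Enumerates (NonConstant Shape201) (nonConstant n) n
    enumNC = nonConstant-enumerates classified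
    to : w ∈ X (suc n) → GoodX w × length w ≡ suc n
    to w∈ with ∈-++⁻ (map (0 ∷_) (nonConstant n)) w∈
    ... | inj₁ w∈₁ with ∈-map⁻ (0 ∷_) w∈₁
    ...   | v , v∈ , refl with Equivalence.to (enumNC v) v∈
    ...     | nc , l = (0 , v , refl , nc) , cong suc l
    to w∈ | inj₂ w∈₂ with ∈-map⁻ insert1 w∈₂
    ...   | u , u∈ , refl with Equivalence.to (enumX u) u∈
    ...     | (j , w₂ , refl , nc₂) , l = (suc j , w₂ , refl , nc₂) , cong suc l
    from : GoodX w × length w ≡ suc n → w ∈ X (suc n)
    from ((zero , w₂ , refl , nc₂) , l) = ∈-++⁺ˡ (∈-map⁺ (0 ∷_) (Equivalence.from (enumNC w₂) (nc₂ , suc-injective l)))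
    from ((suc j , w₂ , refl , nc₂) , l) = ∈-++⁺ʳ (map (0 ∷_) (nonConstant n)) (∈-map⁺ insert1
      (Equivalence.from (enumX _) ((j , w₂ , refl , nc₂) , suc-injective l)))

  Y-step : ∀ {n} → Classified n → Enumerates GoodY (Y (suc n)) (suc n)
  Y-step {n} classified@(_ , enumY) w = mk⇔ to from
    where
    enumNE : Enumerates (NonEmpty Shape201) (nonEmpty n) n
    enumNE = nonEmpty-enumerates classified
    to : w ∈ Y (suc n) → GoodY w × length w ≡ suc n
    to w∈ with ∈-++⁻ (map (_++ [ 0 ]) (Y n)) w∈
    ... | inj₁ w∈₁ with ∈-map⁻ (_++ [ 0 ]) w∈₁
    ...   | v , v∈ , refl with Equivalence.to (enumY v) v∈
    ...     | (k , w₁ , refl , ne₁) , l =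
              (suc k , w₁ , extend-zeros w₁ k , ne₁) , trans (length-snoc (shift w₁ ++ zeros k) 0) (cong suc l)
    to w∈ | inj₂ w∈₂ with ∈-map⁻ shift w∈₂
    ...   | u , u∈ , refl with Equivalence.to (enumNE u) u∈
    ...     | ne , l = (0 , u , sym (++-identityʳ (shift u)) , ne) , cong suc (trans (length-map suc u) l)
    from : GoodY w × length w ≡ suc n → w ∈ Y (suc n)
    from ((zero , w₁ , refl , ne₁) , l) = subst (_∈ Y (suc n)) (sym (++-identityʳ (shift w₁)))
      (∈-++⁺ʳ (map (_++ [ 0 ]) (Y n)) (∈-map⁺ shift (Equivalence.from (enumNE w₁)
        (ne₁ , suc-injective (trans (cong suc (sym (length-map suc w₁))) (trans (cong length (sym (++-identityʳ (shift w₁)))) l))))))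
    from ((suc k , w₁ , refl , ne₁) , l) = subst (_∈ Y (suc n)) (extend-zeros w₁ k) (∈-++⁺ˡ (∈-map⁺ (_++ [ 0 ])
      (Equivalence.from (enumY _) ((k , w₁ , refl , ne₁) ,
        suc-injective (trans (sym (length-snoc (shift w₁ ++ zeros k) 0)) (trans (cong length (extend-zeros w₁ k)) l))))))

  classified : ∀ n → Classified n
  classified zero    = (λ w → mk⇔ (λ ()) λ { ((_ , _ , refl , _) , ()) })
                     , (λ w → mk⇔ (λ ()) λ { ((_ , _ , refl , _) , ()) })
  classified (suc n) = X-step (classified n) , Y-step (classified n)

  goodX : ∀ {n w} → w ∈ X n → GoodX w
  goodX {n} w∈ = proj₁ (Equivalence.to (proj₁ (classified n) _) w∈)

  nonConstant⇒ : ∀ {n w} → w ∈ nonConstant n → NonConstant Shape201 w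
  nonConstant⇒ {n} w∈ = proj₁ (Equivalence.to (nonConstant-enumerates (classified n) _) w∈)

  nonEmpty⇒ : ∀ {n w} → w ∈ nonEmpty n → NonEmpty Shape201 w
  nonEmpty⇒ {n} w∈ = proj₁ (Equivalence.to (nonEmpty-enumerates (classified n) _) w∈)

  unique : ∀ n → Unique (X n) × Unique (Y n)
  unique zero    = [] , []
  unique (suc n) with unique n
  ... | uX , uY =
    unique-map-++ ∷-injectiveʳ insert1-injective 0∷≢insert1 (nonConstant-unique (classified n) uX uY) uX ,
    unique-map-++ (∷ʳ-injectiveˡ _ _) (map-injective suc-injective ∘ ∷-injectiveʳ) snoc0≢shift uY (nonEmpty-unique (classified n) uX uY)
    where
    insert1-injective : ∀ {u v} → insert1 u ≡ insert1 v → u ≡ v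
    insert1-injective {[]}    {[]}    _    = refl
    insert1-injective {_ ∷ _} {_ ∷ _} refl = refl
    0∷≢insert1 : ∀ {v u} → v ∈ nonConstant n → u ∈ X n → 0 ∷ v ≢ insert1 u
    0∷≢insert1 {u = []}    _  _ ()
    0∷≢insert1 {u = _ ∷ _} v∈ _ refl with nonConstant⇒ {n} v∈
    ... | (() , _) , _
    snoc0≢shift : ∀ {v u} → v ∈ Y n → u ∈ nonEmpty n → v ++ [ 0 ] ≢ shift u
    snoc0≢shift {[]}    {u} _ u∈ e = proj₂ (proj₂ (nonEmpty⇒ {n} u∈)) (map-injective suc-injective (∷-injectiveʳ (sym e)))
    snoc0≢shift {_ ∷ v} {u} _ _  e = ¬allPositive-0 v (subst AllPositive (sym (∷-injectiveʳ e)) (allPositive-map-suc u))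

  -- secondZero w is 1 exactly when inserting a 1 after the first letter of w creates a descent.
  secondZero : List ℕ → ℕ
  secondZero (_ ∷ 0 ∷ _) = 1
  secondZero _           = 0

  des-insert1 : ∀ r → des (insert1 (0 ∷ r)) ≡ des (0 ∷ r) + secondZero (0 ∷ r)
  des-insert1 []          = refl
  des-insert1 (zero ∷ r)  = +-comm 1 (des (0 ∷ r))
  des-insert1 (suc _ ∷ r) = sym (+-identityʳ _)

  created : ℕ → ℕ
  created n = total secondZero (X n) + total (lastExceeds 0) (Y n)

  nonConstant-step : ∀ n → length (nonConstant (suc n)) ≡ length (nonConstant n) + length (nonConstant n) + length (nonEmpty n)
  nonConstant-step n = begin
    length (X (suc n) ++ Y (suc n))         ≡⟨ length-++ (X (suc n)) ⟩
    length (X (suc n)) + length (Y (suc n)) ≡⟨ cong₂ _+_ (length-map-++ (0 ∷_) insert1 (nonConstant n) (X n))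
                                                         (length-map-++ (_++ [ 0 ]) shift (Y n) (nonEmpty n)) ⟩
    nC + length (X n) + (length (Y n) + nE) ≡⟨ rearrange nC (length (X n)) (length (Y n)) nE ⟩
    nC + (length (X n) + length (Y n)) + nE ≡⟨ cong (λ t → nC + t + nE) (sym (length-++ (X n))) ⟩
    nC + nC + nE                            ∎
    where
    open ≡-Reasoning
    nC nE : ℕ
    nC = length (nonConstant n)
    nE = length (nonEmpty n)
    rearrange : ∀ c x y e → c + x + (y + e) ≡ c + (x + y) + e
    rearrange = ℕ-Solver.solve-∀

  descents-step : ∀ n → total des (nonConstant (suc n)) ≡ 3 * total des (nonConstant n) + created n
  descents-step n = begin
    total des (X (suc n) ++ Y (suc n))                ≡⟨ total-++ des (X (suc n)) (Y (suc n)) ⟩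
    total des (X (suc n)) + total des (Y (suc n))     ≡⟨ cong₂ _+_ X-descents Y-descents ⟩
    (D + (dX + sX)) + ((dY + eY) + D)                 ≡⟨ cong (λ t → t + (dX + sX) + (dY + eY + t)) (total-++ des (X n) (Y n)) ⟩
    ((dX + dY) + (dX + sX)) + ((dY + eY) + (dX + dY)) ≡⟨ rearrange dX dY sX eY ⟩
    3 * (dX + dY) + (sX + eY)                         ≡⟨ cong (λ t → 3 * t + created n) (sym (total-++ des (X n) (Y n))) ⟩
    3 * D + created n                                 ∎
    where
    open ≡-Reasoning
    D dX dY sX eY : ℕ
    D  = total des (nonConstant n)
    dX = total des (X n)
    dY = total des (Y n)
    sX = total secondZero (X n)
    eY = total (lastExceeds 0) (Y n)
    rearrange : ∀ a b s e → (a + b) + (a + s) + ((b + e) + (a + b)) ≡ 3 * (a + b) + (s + e)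
    rearrange = ℕ-Solver.solve-∀
    des-insert1-X : ∀ {w} → w ∈ X n → des (insert1 w) ≡ des w + secondZero w
    des-insert1-X w∈ with nonConstant-head (goodX⇒ (goodX {n} w∈))
    ... | r , refl = des-insert1 r
    X-descents : total des (X (suc n)) ≡ D + (dX + sX)
    X-descents = trans (total-map-++ des (0 ∷_) insert1 (nonConstant n) (X n))
      (cong₂ _+_ (total-cong (nonConstant n) (λ {w} _ → des-0∷ w))
                 (trans (total-cong (X n) des-insert1-X) (total-+ des secondZero (X n))))
    Y-descents : total des (Y (suc n)) ≡ (dY + eY) + D
    Y-descents = trans (total-map-++ des (_++ [ 0 ]) shift (Y n) (nonEmpty n))
      (cong₂ _+_ (trans (total-cong (Y n) (λ {w} _ → des-snoc w 0)) (total-+ des (lastExceeds 0) (Y n)))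
                 (trans (total-cong (nonEmpty n) (λ {w} _ → des-shift w)) (nonEmpty-descents n)))

  created-step : ∀ n → created (suc n) ≡ length (nonConstant n) + length (nonEmpty n)
  created-step n = cong₂ _+_ X-secondZero Y-endsPositive
    where
    X-secondZero : total secondZero (X (suc n)) ≡ length (nonConstant n)
    X-secondZero = trans (total-map-++ secondZero (0 ∷_) insert1 (nonConstant n) (X n))
      (trans (cong₂ _+_ (total-1 (nonConstant n) secondZero-0∷) (total-0 (X n) (λ {w} _ → secondZero-insert1 w)))
             (+-identityʳ _))
      where
      secondZero-0∷ : ∀ {w} → w ∈ nonConstant n → secondZero (0 ∷ w) ≡ 1
      secondZero-0∷ w∈ with nonConstant-head (nonConstant⇒ {n} w∈)
      ... | _ , refl = refl
      secondZero-insert1 : ∀ w → secondZero (insert1 w) ≡ 0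
      secondZero-insert1 []      = refl
      secondZero-insert1 (_ ∷ _) = refl
    Y-endsPositive : total (lastExceeds 0) (Y (suc n)) ≡ length (nonEmpty n)
    Y-endsPositive = trans (total-map-++ (lastExceeds 0) (_++ [ 0 ]) shift (Y n) (nonEmpty n))
      (cong₂ _+_ (total-0 (Y n) (λ {w} _ → lastExceeds-snoc w 0 0)) (total-1 (nonEmpty n) shift-endsPositive))
      where
      shift-endsPositive : ∀ {w} → w ∈ nonEmpty n → lastExceeds 0 (shift w) ≡ 1
      shift-endsPositive {[]}    w∈ = ⊥-elim (proj₂ (proj₂ (nonEmpty⇒ {n} w∈)) refl)
      shift-endsPositive {a ∷ t} _  = lastExceeds-map-suc a t

  open Counted classified unique refl nonConstant-step created refl refl descents-step created-step public
    using (enumeration)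

enumeration : ∀ {p} → p ≡ p102 ⊎ p ≡ p201 → Enumeration (λ w → Avoids w p)
enumeration (inj₁ refl) = enumeration-⇔ (λ {w} → ¬-cong-⇔ (occurs⇔contains102 {w})) Avoid102.enumeration
enumeration (inj₂ refl) = enumeration-⇔ (λ {w} → ¬-cong-⇔ (occurs⇔contains201 {w})) Avoid201.enumeration

corollary5 : ∀ (p : List ℕ) → (p ≡ p102 ⊎ p ≡ p201) →
    Σ (ℕ → List (List ℕ)) λ C →
      ((n : ℕ) → Unique (C n))
      × ((n : ℕ) (w : List ℕ) → (w ∈ C n) ⇔ (CatalanWord w × length w ≡ n × Avoids w p))
      × ((n : ℕ) → (poly (+ 1 ∷ -[1+ 3 ] ∷ + 3 ∷ []) ⊛ (λ m → + length (C m))) n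
                     ≡ poly (+ 1 ∷ -[1+ 2 ] ∷ + 1 ∷ []) n)
      × ((n : ℕ) → 1 ≤ n → length (C n) ≡ (3 ^ (n ∸ 1) + 1) / 2)
      × ((n : ℕ) → 2 ≤ n → sum (map des (C n)) ≡ (n ∸ 2) * 3 ^ (n ∸ 3))
      × ((n : ℕ) → (poly (+ 1 ∷ -[1+ 5 ] ∷ + 9 ∷ []) ⊛ (λ m → + sum (map des (C m)))) n
                     ≡ poly (+ 0 ∷ + 0 ∷ + 0 ∷ + 1 ∷ []) n)
corollary5 p p∈ =
  words , unique , members , count-gf count , count-closed count , descents-closed descents , descents-gf descents
  where open Enumeration (enumeration p∈)
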